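{- Let $q$ be a power of a prime $p$, $n\ge 2$, $\pi\in S_n$, and let $\tilde A=u[\pi]$ for some $u\in\mathbb{U}_\pi$ (a representative of a left $\mathbb{B}^+$-coset contained in the double coset $\mathbb{U}_\pi[\pi]\mathbb{B}^+$ of $GL_n(\mathbb{F}_q)$). If some column of $\tilde A$ other than the last ($n$-th) column has entry sum different from $0$ in $\mathbb{F}_q$, then $$\sum_{K\in\tilde A\mathbb{B}^+}\omega_q^{s(K)}=0,$$ where $\tilde A\mathbb{B}^+=\{\tilde AB: B\in\mathbb{B}^+\}$.
   Context: $\mathbb{B}^+$ is the group of invertible upper triangular $n\times n$ matrices over $\mathbb{F}_q$, and $\mathbb{U}^-$ is the group of lower triangular $n\times n$ matrices over $\mathbb{F}_q$ with $1$'s on the diagonal. A permutation $\pi\in S_n$ is identified with the matrix $[\pi]$ with $[\pi]_{i,j}=1$ if $i=\pi(j)$ and $0$ otherwise, and $\mathbb{U}_\pi=\mathbb{U}^-\cap([\pi]\mathbb{U}^-[\pi]^{ -1})$. Fix a bijection $\varphi:\mathbb{F}_q\to\{0,\dots,q-1\}$ with $\varphi(0)=0$; for a matrix $K$, $s(K)=\varphi(\sigma(K))$ where $\sigma(K)$ is the sum of all entries of $K$ in $\mathbb{F}_q$. $\omega_q$ is a primitive complex $q$-th root of unity. -}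

module Defs where

open import Level using (Level; _⊔_; suc)
open import Data.Nat as ℕ using (ℕ; zero; suc; _<_)
open import Data.Fin using (Fin; toℕ)
open import Data.Fin.Permutation using (Permutation′; _⟨$⟩ʳ_; flip)
open import Data.Vec using (Vec; lookup; tabulate)
open import Data.List using (List; length; map; foldr)
open import Data.List.Membership.Propositional using (_∈_)
open import Data.List.Relation.Unary.Unique.Propositional using (Unique)
open import Data.Product using (Σ; ∃; _×_)
open import Relation.Binary.PropositionalEquality using (_≡_; _≢_)
open import Relation.Nullary using (¬_; Dec)
open import Algebra.Structures using (IsCommutativeRing)
open import Algebra.Bundles using (CommutativeRing)

-- A finite field (with propositional equality), together with an
-- explicit duplicate-free exhaustive enumeration of its elements.
-- Its order q = length elements is automatically a prime power.

record FiniteField : Set₁ where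
  infixl 6 _+_
  infixl 7 _*_
  field
    Carrier : Set
    _+_ _*_ : Carrier → Carrier → Carrier
    -_      : Carrier → Carrier
    0# 1#   : Carrier
    isCommutativeRing : IsCommutativeRing _≡_ _+_ _*_ -_ 0# 1#
    0≢1     : 0# ≢ 1#
    inverse : ∀ x → x ≢ 0# → ∃ λ y → x * y ≡ 1#
    _≟_     : (x y : Carrier) → Dec (x ≡ y)
    elements : List Carrier
    complete : ∀ x → x ∈ elements
    unique   : Unique elements

  order : ℕ
  order = length elements

module Matrices (F : FiniteField) where
  open FiniteField F

  Matrix : ℕ → Set
  Matrix n = Vec (Vec Carrier n) n

  entry : ∀ {n} → Matrix n → Fin n → Fin n → Carrier
  entry A i j = lookup (lookup A i) j

  mkMatrix : ∀ {n} → (Fin n → Fin n → Carrier) → Matrix n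
  mkMatrix f = tabulate (λ i → tabulate (λ j → f i j))

  ∑ : ∀ {n} → (Fin n → Carrier) → Carrier
  ∑ {zero}  f = 0#
  ∑ {suc n} f = f Data.Fin.zero + ∑ (λ i → f (Data.Fin.suc i))

  _·_ : ∀ {n} → Matrix n → Matrix n → Matrix n
  A · B = mkMatrix (λ i j → ∑ (λ k → entry A i k * entry B k j))

  identity : ∀ {n} → Matrix n
  identity = mkMatrix (λ i j → δ i j)
    where
      δ : ∀ {n} → Fin n → Fin n → Carrier
      δ i j with i Data.Fin.≟ j
      ... | Relation.Nullary.yes _ = 1#
      ... | Relation.Nullary.no  _ = 0#

  permMatrix : ∀ {n} → Permutation′ n → Matrix n
  permMatrix π = mkMatrix (λ i j → ind i (π ⟨$⟩ʳ j))
    where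
      ind : ∀ {n} → Fin n → Fin n → Carrier
      ind i k with i Data.Fin.≟ k
      ... | Relation.Nullary.yes _ = 1#
      ... | Relation.Nullary.no  _ = 0#

  Invertible : ∀ {n} → Matrix n → Set
  Invertible {n} A = ∃ λ (C : Matrix n) → (A · C ≡ identity) × (C · A ≡ identity)

  InB⁺ : ∀ {n} → Matrix n → Set
  InB⁺ B = Invertible B × (∀ i j → toℕ j < toℕ i → entry B i j ≡ 0#)

  InU⁻ : ∀ {n} → Matrix n → Set
  InU⁻ u = (∀ i j → toℕ i < toℕ j → entry u i j ≡ 0#) × (∀ i → entry u i i ≡ 1#)

  -- 𝕌_π = 𝕌⁻ ∩ [π] 𝕌⁻ [π]⁻¹   (note [π]⁻¹ = [π⁻¹])
  InUπ : ∀ {n} → Permutation′ n → Matrix n → Set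
  InUπ {n} π u = InU⁻ u ×
    (∃ λ (v : Matrix n) → InU⁻ v × (u ≡ (permMatrix π · v) · permMatrix (flip π)))

  InCoset : ∀ {n} → Matrix n → Matrix n → Set
  InCoset {n} Ã K = ∃ λ (B : Matrix n) → InB⁺ B × (K ≡ Ã · B)

  columnSum : ∀ {n} → Matrix n → Fin n → Carrier
  columnSum A j = ∑ (λ i → entry A i j)

  σ : ∀ {n} → Matrix n → Carrier
  σ K = ∑ (λ i → ∑ (λ j → entry K i j))

-- The coefficient domain standing in for ℂ: a commutative ring which is
-- an integral domain of characteristic 0, with a primitive q-th root ω.

module Target {c ℓ : Level} (C : CommutativeRing c ℓ) where
  open CommutativeRing C

  pow : Carrier → ℕ → Carrier
  pow x zero    = 1#
  pow x (suc k) = x * pow x k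

  natMul : ℕ → Carrier
  natMul zero    = 0#
  natMul (suc k) = 1# + natMul k

  IntegralDomain : Set (c ⊔ ℓ)
  IntegralDomain = (¬ (1# ≈ 0#)) × (∀ x y → x * y ≈ 0# → (x ≈ 0#) Data.Sum.⊎ (y ≈ 0#))
    where import Data.Sum

  Characteristic0 : Set ℓ
  Characteristic0 = ∀ k → natMul k ≈ 0# → k ≡ 0

  PrimitiveRoot : ℕ → Carrier → Set ℓ
  PrimitiveRoot q ω = (pow ω q ≈ 1#) × (∀ k → 0 < k → k < q → ¬ (pow ω k ≈ 1#))

  sumList : List Carrier → Carrier
  sumList = foldr _+_ 0#

{-# OPTIONS --safe #-}
module Submission where

-- Let Ã = u[π], let j be a column other than the last with entry sum a ≠ 0, and put l = j + 1.
-- For t ∈ 𝔽_q the map K ↦ K + t·Ã E_{jl} sends Ã B to Ã (B + t E_{jl}). The inverse of an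
-- invertible upper triangular B is upper triangular, so as j < l, B + t E_{jl} again lies in 𝔹⁺
-- and the map permutes the coset Ã𝔹⁺, while it shifts σ(K) by t·a. Averaging over t gives
--   q · Σ_K ω^{s(K)} = Σ_K Σ_{x ∈ 𝔽_q} ω^{φ(x)} = Σ_K Σ_{m < q} ω^m = 0,
-- and q ≠ 0 in an integral domain of characteristic 0.

open import Defs
open import Level using (Level)
open import Data.Nat as ℕ using (ℕ; zero; suc; _≤_; _<_; _^_; s≤s; z≤n)
import Data.Nat.Properties as ℕ
open import Data.Nat.Primality using (Prime)
open import Data.Fin as Fin using (Fin; toℕ)
open import Data.Fin.Induction using (<-wellFounded)
open import Data.Fin.Permutation using (Permutation′)
open import Data.Fin.Properties using (punchInᵢ≢i; <-cmp; <-irrefl; <-trans; toℕ-fromℕ<)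
open import Data.Vec using (lookup)
open import Data.Vec.Properties using (lookup∘tabulate; tabulate∘lookup; tabulate-cong)
open import Data.List using (List; []; _∷_; map; length; allFin; tabulate)
open import Data.List.Properties using (map-∘; map-cong; map-tabulate)
open import Data.List.Membership.Propositional using (_∈_)
open import Data.List.Membership.Propositional.Properties using (∈-map⁺; ∈-map⁻; ∈-allFin)
open import Data.List.Membership.Propositional.Properties.WithK using (unique∧set⇒bag)
open import Data.List.Relation.Unary.Unique.Propositional using (Unique)
import Data.List.Relation.Unary.Unique.Propositional.Properties as Unique
open import Data.List.Relation.Binary.BagAndSetEquality using (∼bag⇒↭)
open import Data.List.Relation.Binary.Permutation.Propositional using (_↭_; ↭⇒↭ₛ′)
import Data.List.Relation.Binary.Permutation.Propositional.Properties as ↭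
open import Data.Product using (∃; _×_; _,_)
open import Data.Sum using (inj₁; inj₂)
open import Data.Empty using (⊥-elim)
open import Function using (_∘_; id)
open import Function.Bundles using (_↔_; _⇔_; Inverse; Injection; Equivalence; mk⇔)
open import Function.Properties.Inverse using (↔⇒↣)
open import Induction.WellFounded using (module All)
open import Algebra.Bundles using (CommutativeRing)
open import Relation.Binary.Definitions using (tri<; tri≈; tri>)
open import Relation.Binary.PropositionalEquality as ≡ using (_≡_; _≢_)
open import Relation.Nullary using (yes; no)

private variable X Y : Set

map-↭ : {f : X → Y} {g : Y → X} {xs : List X} {ys : List Y} →
        Unique xs → Unique ys → (∀ x → g (f x) ≡ x) → (∀ y → f (g y) ≡ y) →
        (∀ {x} → x ∈ xs → f x ∈ ys) → (∀ {y} → y ∈ ys → g y ∈ xs) →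
        map f xs ↭ ys
map-↭ {f = f} {g} {xs} {ys} xs-unique ys-unique g∘f f∘g f∈ g∈ =
  ∼bag⇒↭ (unique∧set⇒bag (Unique.map⁺ f-injective xs-unique) ys-unique (mk⇔ to from))
  where
  f-injective : ∀ {x x′} → f x ≡ f x′ → x ≡ x′
  f-injective {x} {x′} eq = ≡.trans (≡.sym (g∘f x)) (≡.trans (≡.cong g eq) (g∘f x′))
  to : ∀ {y} → y ∈ map f xs → y ∈ ys
  to y∈ with _ , x∈ , ≡.refl ← ∈-map⁻ f y∈ = f∈ x∈
  from : ∀ {y} → y ∈ ys → y ∈ map f xs
  from {y} y∈ = ≡.subst (_∈ map f xs) (f∘g y) (∈-map⁺ f (g∈ y∈))

distinct⇒1< : ∀ {q} {a b : Fin q} → a ≢ b → 1 < q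
distinct⇒1< {suc zero}    {Fin.zero} {Fin.zero} a≢b = ⊥-elim (a≢b ≡.refl)
distinct⇒1< {suc (suc q)} _                          = s≤s (s≤s z≤n)

module TargetProperties {c ℓ : Level} (R : CommutativeRing c ℓ) where
  open CommutativeRing R
  open Target R
  open import Algebra.Properties.Ring ring using (+-cancelʳ; -1*x≈-x; x∙y⁻¹≈ε⇒x≈y)
  open import Algebra.Solver.Ring.NaturalCoefficients.Default commutativeSemiring using (solve; _:=_; _:+_; _:*_)
  open import Data.List.Relation.Binary.Permutation.Setoid.Properties setoid using (foldr-commMonoid)
  open import Relation.Binary.Reasoning.Setoid setoid

  sumList-↭ : {xs ys : List Carrier} → xs ↭ ys → sumList xs ≈ sumList ys
  sumList-↭ xs↭ys = foldr-commMonoid +-isCommutativeMonoid (↭⇒↭ₛ′ isEquivalence xs↭ys)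

  sumList-map-cong : {f g : X → Carrier} (xs : List X) → (∀ x → f x ≈ g x) →
                     sumList (map f xs) ≈ sumList (map g xs)
  sumList-map-cong []       f≈g = refl
  sumList-map-cong (x ∷ xs) f≈g = +-cong (f≈g x) (sumList-map-cong xs f≈g)

  sumList-map-+ : (f g : X → Carrier) (xs : List X) →
                  sumList (map (λ x → f x + g x) xs) ≈ sumList (map f xs) + sumList (map g xs)
  sumList-map-+ f g []       = sym (+-identityʳ 0#)
  sumList-map-+ f g (x ∷ xs) =
    trans (+-congˡ (sumList-map-+ f g xs))
          (solve 4 (λ a b c d → (a :+ b) :+ (c :+ d) := (a :+ c) :+ (b :+ d)) refl _ _ _ _)

  sumList-map-*ˡ : (c : Carrier) (f : X → Carrier) (xs : List X) →
                   sumList (map (λ x → c * f x) xs) ≈ c * sumList (map f xs)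
  sumList-map-*ˡ c f []       = sym (zeroʳ c)
  sumList-map-*ˡ c f (x ∷ xs) = trans (+-congˡ (sumList-map-*ˡ c f xs)) (sym (distribˡ c _ _))

  sumList-map-const : (s : Carrier) (xs : List X) → sumList (map (λ _ → s) xs) ≈ natMul (length xs) * s
  sumList-map-const s []       = sym (zeroˡ s)
  sumList-map-const s (x ∷ xs) =
    trans (+-cong (sym (*-identityˡ s)) (sumList-map-const s xs)) (sym (distribʳ s 1# _))

  sumList-map-0# : (xs : List X) → sumList (map (λ _ → 0#) xs) ≈ 0#
  sumList-map-0# xs = trans (sumList-map-const 0# xs) (zeroʳ _)

  sumList-map-comm : (h : X → Y → Carrier) (xs : List X) (ys : List Y) →
                     sumList (map (λ x → sumList (map (h x) ys)) xs) ≈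
                     sumList (map (λ y → sumList (map (λ x → h x y) xs)) ys)
  sumList-map-comm h []       ys = sym (sumList-map-0# ys)
  sumList-map-comm h (x ∷ xs) ys =
    trans (+-congˡ (sumList-map-comm h xs ys)) (sym (sumList-map-+ (h x) _ ys))

  natMul-cancel : IntegralDomain → Characteristic0 → ∀ {k x} → k ≢ 0 → natMul k * x ≈ 0# → x ≈ 0#
  natMul-cancel (_ , noZeroDivisors) char0 k≢0 kx≈0 with noZeroDivisors _ _ kx≈0
  ... | inj₁ k≈0 = ⊥-elim (k≢0 (char0 _ k≈0))
  ... | inj₂ x≈0 = x≈0

  module _ (ω : Carrier) where

    powerSum : ℕ → Carrier
    powerSum q = sumList (map (pow ω ∘ toℕ) (allFin q))

    powerSum-suc : ∀ q → powerSum (suc q) ≈ 1# + ω * powerSum q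
    powerSum-suc q = +-congˡ (begin
      sumList (map (pow ω ∘ toℕ) (tabulate {n = q} Fin.suc))
        ≡⟨ ≡.cong sumList (map-tabulate {n = q} Fin.suc (pow ω ∘ toℕ)) ⟩
      sumList (tabulate {n = q} (λ i → ω * pow ω (toℕ i)))
        ≡⟨ ≡.cong sumList (map-tabulate {n = q} id (λ i → ω * pow ω (toℕ i))) ⟨
      sumList (map (λ i → ω * pow ω (toℕ i)) (allFin q))
        ≈⟨ sumList-map-*ˡ ω _ (allFin q) ⟩
      ω * powerSum q
        ∎)

    powerSum-telescope : ∀ q → ω * powerSum q + 1# ≈ powerSum q + pow ω q
    powerSum-telescope zero    = +-congʳ (zeroʳ ω)
    powerSum-telescope (suc q) = begin
      ω * powerSum (suc q) + 1#            ≈⟨ +-congʳ (*-congˡ (powerSum-suc q)) ⟩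
      ω * (1# + ω * powerSum q) + 1#       ≈⟨ solve 3 (λ w o s → w :* (o :+ w :* s) :+ o := w :* (w :* s :+ o) :+ o) refl ω 1# _ ⟩
      ω * (ω * powerSum q + 1#) + 1#       ≈⟨ +-congʳ (*-congˡ (powerSum-telescope q)) ⟩
      ω * (powerSum q + pow ω q) + 1#      ≈⟨ solve 4 (λ w o s p → w :* (s :+ p) :+ o := (o :+ w :* s) :+ w :* p) refl ω 1# _ _ ⟩
      (1# + ω * powerSum q) + ω * pow ω q  ≈⟨ +-congʳ (powerSum-suc q) ⟨
      powerSum (suc q) + pow ω (suc q)     ∎

    powerSum≈0 : IntegralDomain → ∀ {q} → 1 < q → PrimitiveRoot q ω → powerSum q ≈ 0#
    powerSum≈0 (_ , noZeroDivisors) {q} 1<q (ω^q≈1 , ω^k≉1)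
      with noZeroDivisors (ω - 1#) (powerSum q) [ω-1]S≈0
      where
      ωS≈S : ω * powerSum q ≈ powerSum q
      ωS≈S = +-cancelʳ 1# _ _ (trans (powerSum-telescope q) (+-congˡ ω^q≈1))
      [ω-1]S≈0 : (ω - 1#) * powerSum q ≈ 0#
      [ω-1]S≈0 = begin
        (ω - 1#) * powerSum q               ≈⟨ distribʳ _ ω (- 1#) ⟩
        ω * powerSum q + - 1# * powerSum q  ≈⟨ +-cong ωS≈S (-1*x≈-x _) ⟩
        powerSum q - powerSum q             ≈⟨ -‿inverseʳ _ ⟩
        0#                                  ∎
    ... | inj₂ S≈0   = S≈0
    ... | inj₁ ω-1≈0 =
      ⊥-elim (ω^k≉1 1 (s≤s z≤n) 1<q (trans (*-identityʳ ω) (x∙y⁻¹≈ε⇒x≈y ω 1# ω-1≈0)))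

module FiniteFieldProperties (F : FiniteField) where
  open FiniteField F

  ring : CommutativeRing _ _
  ring = record { isCommutativeRing = isCommutativeRing }

  open CommutativeRing ring using (*-assoc; *-identityʳ; +-assoc; +-identityʳ; zeroˡ; zeroʳ)
  open import Algebra.Properties.Ring (CommutativeRing.ring ring) using (xyx⁻¹≈y)
  open import Algebra.Solver.Ring.NaturalCoefficients.Default (CommutativeRing.commutativeSemiring ring)
    using (solve; _:=_; _:+_; _:*_)
  open ≡.≡-Reasoning

  +-*-cancel : ∀ a b c {s t} → s + t ≡ 0# → a + b * (s * c) + b * (t * c) ≡ a
  +-*-cancel a b c {s} {t} s+t≡0 = begin
    a + b * (s * c) + b * (t * c)  ≡⟨ solve 5 (λ a b c s t → a :+ b :* (s :* c) :+ b :* (t :* c) := a :+ b :* ((s :+ t) :* c)) ≡.refl a b c s t ⟩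
    a + b * ((s + t) * c)          ≡⟨ ≡.cong (λ x → a + b * (x * c)) s+t≡0 ⟩
    a + b * (0# * c)               ≡⟨ ≡.cong (λ x → a + b * x) (zeroˡ c) ⟩
    a + b * 0#                     ≡⟨ ≡.cong (a +_) (zeroʳ b) ⟩
    a + 0#                         ≡⟨ +-identityʳ a ⟩
    a                              ∎

  affine-↭ : ∀ {a} → a ≢ 0# → ∀ s → map (λ t → s + t * a) elements ↭ elements
  affine-↭ {a} a≢0 s with inverse a a≢0
  ... | b , ab≡1 = map-↭ unique unique left-inverse right-inverse (λ _ → complete _) (λ _ → complete _)
    where
    left-inverse : ∀ t → (s + t * a + - s) * b ≡ t
    left-inverse t = begin
      (s + t * a + - s) * b  ≡⟨ ≡.cong (_* b) (xyx⁻¹≈y s (t * a)) ⟩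
      t * a * b              ≡⟨ *-assoc t a b ⟩
      t * (a * b)            ≡⟨ ≡.cong (t *_) ab≡1 ⟩
      t * 1#                 ≡⟨ *-identityʳ t ⟩
      t                      ∎
    right-inverse : ∀ y → s + (y + - s) * b * a ≡ y
    right-inverse y = begin
      s + (y + - s) * b * a    ≡⟨ ≡.cong (s +_) (solve 3 (λ d b a → d :* b :* a := d :* (a :* b)) ≡.refl (y + - s) b a) ⟩
      s + (y + - s) * (a * b)  ≡⟨ ≡.cong (λ u → s + (y + - s) * u) ab≡1 ⟩
      s + (y + - s) * 1#       ≡⟨ ≡.cong (s +_) (*-identityʳ _) ⟩
      s + (y + - s)            ≡⟨ +-assoc s y (- s) ⟨
      s + y + - s              ≡⟨ xyx⁻¹≈y s y ⟩
      y                        ∎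

module MatrixProperties (F : FiniteField) where
  open FiniteField F
  open Matrices F
  open FiniteFieldProperties F using (ring; +-*-cancel)
  open CommutativeRing ring using (+-identityʳ; *-identityˡ; *-identityʳ; -‿inverseʳ; zeroˡ; zeroʳ; *-assoc; *-comm)
  open import Algebra.Properties.Semiring.Sum (CommutativeRing.semiring ring)
    using (sum; sum-cong-≗; ∑-distrib-+; *-distribˡ-sum; *-distribʳ-sum; sum-remove; sum-replicate-zero)
  open import Algebra.Solver.Ring.NaturalCoefficients.Default (CommutativeRing.commutativeSemiring ring)
    using (solve; _:=_; _:+_; _:*_; con)
  open ≡.≡-Reasoning

  ∑≡sum : ∀ {n} (f : Fin n → Carrier) → ∑ f ≡ sum f
  ∑≡sum {zero}  f = ≡.refl
  ∑≡sum {suc n} f = ≡.cong (f Fin.zero +_) (∑≡sum (f ∘ Fin.suc))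

  sum-zero : ∀ {n} {f : Fin n → Carrier} → (∀ i → f i ≡ 0#) → sum f ≡ 0#
  sum-zero {n} f≡0 = ≡.trans (sum-cong-≗ f≡0) (sum-replicate-zero n)

  sum-single : ∀ {n} (f : Fin n → Carrier) (i : Fin n) → (∀ m → m ≢ i → f m ≡ 0#) → sum f ≡ f i
  sum-single {suc n} f i others≡0 = begin
    sum f                                  ≡⟨ sum-remove f ⟩
    f i + sum (λ m → f (Fin.punchIn i m))  ≡⟨ ≡.cong (f i +_) (sum-zero (λ m → others≡0 _ (punchInᵢ≢i i m))) ⟩
    f i + 0#                               ≡⟨ +-identityʳ (f i) ⟩
    f i                                    ∎

  entry-mkMatrix : ∀ {n} (f : Fin n → Fin n → Carrier) i k → entry (mkMatrix f) i k ≡ f i k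
  entry-mkMatrix f i k = ≡.trans (≡.cong (λ row → lookup row k) (lookup∘tabulate _ i)) (lookup∘tabulate (f i) k)

  mkMatrix-entry : ∀ {n} (A : Matrix n) → mkMatrix (entry A) ≡ A
  mkMatrix-entry A = ≡.trans (tabulate-cong (λ i → tabulate∘lookup (lookup A i))) (tabulate∘lookup A)

  matrix-ext : ∀ {n} {A B : Matrix n} → (∀ i k → entry A i k ≡ entry B i k) → A ≡ B
  matrix-ext {A = A} {B} A≗B = begin
    A                   ≡⟨ mkMatrix-entry A ⟨
    mkMatrix (entry A)  ≡⟨ tabulate-cong (λ i → tabulate-cong (A≗B i)) ⟩
    mkMatrix (entry B)  ≡⟨ mkMatrix-entry B ⟩
    B                   ∎

  -- Applied to `refl`, this exposes to with-abstraction the decision `i ≟ k` hidden in `identity`.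
  entry-of-≡mkMatrix : ∀ {n} {f : Fin n → Fin n → Carrier} (A : Matrix n) → A ≡ mkMatrix f →
                       ∀ i k → entry A i k ≡ f i k
  entry-of-≡mkMatrix A ≡.refl = entry-mkMatrix _

  δ : ∀ {n} → Fin n → Fin n → Carrier
  δ = entry identity

  δ-diag : ∀ {n} (i : Fin n) → δ i i ≡ 1#
  δ-diag i with entry-of-≡mkMatrix identity ≡.refl i i
  ... | δii≡ with i Fin.≟ i
  ...   | yes _   = δii≡
  ...   | no  i≢i = ⊥-elim (i≢i ≡.refl)

  δ-off : ∀ {n} {i k : Fin n} → i ≢ k → δ i k ≡ 0#
  δ-off {i = i} {k} i≢k with entry-of-≡mkMatrix identity ≡.refl i k
  ... | δik≡ with i Fin.≟ k
  ...   | yes i≡k = ⊥-elim (i≢k i≡k)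
  ...   | no  _   = δik≡

  sum-*δ : ∀ {n} (f : Fin n → Carrier) (k : Fin n) → sum (λ m → f m * δ m k) ≡ f k
  sum-*δ f k = begin
    sum (λ m → f m * δ m k)  ≡⟨ sum-single _ k (λ m m≢k → ≡.trans (≡.cong (f m *_) (δ-off m≢k)) (zeroʳ (f m))) ⟩
    f k * δ k k              ≡⟨ ≡.cong (f k *_) (δ-diag k) ⟩
    f k * 1#                 ≡⟨ *-identityʳ (f k) ⟩
    f k                      ∎

  sum-δ* : ∀ {n} (k : Fin n) (f : Fin n → Carrier) → sum (λ m → δ k m * f m) ≡ f k
  sum-δ* k f = begin
    sum (λ m → δ k m * f m)  ≡⟨ sum-single _ k (λ m m≢k → ≡.trans (≡.cong (_* f m) (δ-off (m≢k ∘ ≡.sym))) (zeroˡ (f m))) ⟩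
    δ k k * f k              ≡⟨ ≡.cong (_* f k) (δ-diag k) ⟩
    1# * f k                 ≡⟨ *-identityˡ (f k) ⟩
    f k                      ∎

  entry-· : ∀ {n} (A B : Matrix n) i k → entry (A · B) i k ≡ sum (λ m → entry A i m * entry B m k)
  entry-· {n} A B i k = ≡.trans (entry-mkMatrix _ i k) (∑≡sum {n} _)

  σ≡sum : ∀ {n} (K : Matrix n) → σ K ≡ sum (λ i → sum (λ k → entry K i k))
  σ≡sum {n} K = ≡.trans (∑≡sum {n} _) (sum-cong-≗ {n} (λ i → ∑≡sum {n} _))

  columnSum≡sum : ∀ {n} (A : Matrix n) j → columnSum A j ≡ sum (λ i → entry A i j)
  columnSum≡sum {n} A j = ∑≡sum {n} _

  _⊕_⊗_ : ∀ {n} → Matrix n → (Fin n → Carrier) → (Fin n → Carrier) → Matrix n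
  B ⊕ x ⊗ y = mkMatrix (λ m k → entry B m k + x m * y k)

  ·-⊕ : ∀ {n} (A B : Matrix n) x y i k →
        entry (A · (B ⊕ x ⊗ y)) i k ≡ entry (A · B) i k + sum (λ m → entry A i m * x m) * y k
  ·-⊕ A B x y i k = begin
    entry (A · (B ⊕ x ⊗ y)) i k
      ≡⟨ entry-· A (B ⊕ x ⊗ y) i k ⟩
    sum (λ m → entry A i m * entry (B ⊕ x ⊗ y) m k)
      ≡⟨ sum-cong-≗ (λ m → ≡.trans (≡.cong (entry A i m *_) (entry-mkMatrix _ m k))
                                   (solve 4 (λ a b x y → a :* (b :+ x :* y) := a :* b :+ (a :* x) :* y) ≡.refl _ _ _ _)) ⟩
    sum (λ m → entry A i m * entry B m k + (entry A i m * x m) * y k)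
      ≡⟨ ∑-distrib-+ (λ m → entry A i m * entry B m k) (λ m → (entry A i m * x m) * y k) ⟩
    sum (λ m → entry A i m * entry B m k) + sum (λ m → (entry A i m * x m) * y k)
      ≡⟨ ≡.cong₂ _+_ (entry-· A B i k) (*-distribʳ-sum (y k) (λ m → entry A i m * x m)) ⟨
    entry (A · B) i k + sum (λ m → entry A i m * x m) * y k
      ∎

  ⊕-· : ∀ {n} (B A : Matrix n) x y i k →
        entry ((B ⊕ x ⊗ y) · A) i k ≡ entry (B · A) i k + x i * sum (λ m → y m * entry A m k)
  ⊕-· B A x y i k = begin
    entry ((B ⊕ x ⊗ y) · A) i k
      ≡⟨ entry-· (B ⊕ x ⊗ y) A i k ⟩
    sum (λ m → entry (B ⊕ x ⊗ y) i m * entry A m k)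
      ≡⟨ sum-cong-≗ (λ m → ≡.trans (≡.cong (_* entry A m k) (entry-mkMatrix _ i m))
                                   (solve 4 (λ b x y a → (b :+ x :* y) :* a := b :* a :+ x :* (y :* a)) ≡.refl _ _ _ _)) ⟩
    sum (λ m → entry B i m * entry A m k + x i * (y m * entry A m k))
      ≡⟨ ∑-distrib-+ (λ m → entry B i m * entry A m k) (λ m → x i * (y m * entry A m k)) ⟩
    sum (λ m → entry B i m * entry A m k) + sum (λ m → x i * (y m * entry A m k))
      ≡⟨ ≡.cong₂ _+_ (entry-· B A i k) (*-distribˡ-sum (x i) (λ m → y m * entry A m k)) ⟨
    entry (B · A) i k + x i * sum (λ m → y m * entry A m k)
      ∎

  σ-⊕ : ∀ {n} (K : Matrix n) x y → σ (K ⊕ x ⊗ y) ≡ σ K + sum x * sum y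
  σ-⊕ {n} K x y = begin
    σ (K ⊕ x ⊗ y)
      ≡⟨ σ≡sum (K ⊕ x ⊗ y) ⟩
    sum (λ i → sum (λ k → entry (K ⊕ x ⊗ y) i k))
      ≡⟨ sum-cong-≗ {n} (λ i → ≡.trans (sum-cong-≗ {n} (entry-mkMatrix _ i)) (∑-distrib-+ (entry K i) (λ k → x i * y k))) ⟩
    sum (λ i → sum (λ k → entry K i k) + sum (λ k → x i * y k))
      ≡⟨ sum-cong-≗ {n} (λ i → ≡.cong (sum (entry K i) +_) (*-distribˡ-sum (x i) y)) ⟨
    sum (λ i → sum (λ k → entry K i k) + x i * sum y)
      ≡⟨ ∑-distrib-+ (λ i → sum (entry K i)) (λ i → x i * sum y) ⟩
    sum (λ i → sum (λ k → entry K i k)) + sum (λ i → x i * sum y)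
      ≡⟨ ≡.cong₂ _+_ (σ≡sum K) (*-distribʳ-sum (sum y) x) ⟨
    σ K + sum x * sum y
      ∎

  UpperTriangular : ∀ {n} → Matrix n → Set
  UpperTriangular B = ∀ i k → k Fin.< i → entry B i k ≡ 0#

  -- Induction on the column k: once the columns left of k vanish below the diagonal,
  -- (C·B)_{ik} = C_{ik} B_{kk} for i ≥ k, and B_{kk} is a unit since C_{kk} B_{kk} = 1.
  inverse-upper : ∀ {n} (B C : Matrix n) → UpperTriangular B → C · B ≡ identity → UpperTriangular C
  inverse-upper {n} B C B-upper CB≡I i k = All.wfRec <-wellFounded _ ZeroBelowDiagonal column k i
    where
    ZeroBelowDiagonal : Fin n → Set
    ZeroBelowDiagonal k = ∀ i → k Fin.< i → entry C i k ≡ 0#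

    column : ∀ k → (∀ {m} → m Fin.< k → ZeroBelowDiagonal m) → ZeroBelowDiagonal k
    column k left-columns = below-pivot
      where
      pivot : ∀ i → k Fin.≤ i → entry C i k * entry B k k ≡ δ i k
      pivot i k≤i = begin
        entry C i k * entry B k k                 ≡⟨ sum-single _ k other-terms ⟨
        sum (λ m → entry C i m * entry B m k)     ≡⟨ entry-· C B i k ⟨
        entry (C · B) i k                         ≡⟨ ≡.cong (λ M → entry M i k) CB≡I ⟩
        δ i k                                     ∎
        where
        other-terms : ∀ m → m ≢ k → entry C i m * entry B m k ≡ 0#
        other-terms m m≢k with <-cmp m k
        ... | tri< m<k _ _ = ≡.trans (≡.cong (_* entry B m k) (left-columns m<k i (ℕ.<-≤-trans m<k k≤i))) (zeroˡ _)
        ... | tri≈ _ m≡k _ = ⊥-elim (m≢k m≡k)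
        ... | tri> _ _ k<m = ≡.trans (≡.cong (entry C i m *_) (B-upper m k k<m)) (zeroʳ _)

      below-pivot : ZeroBelowDiagonal k
      below-pivot i k<i = begin
        entry C i k                                ≡⟨ *-identityʳ _ ⟨
        entry C i k * 1#                           ≡⟨ ≡.cong (entry C i k *_) (≡.trans (pivot k ℕ.≤-refl) (δ-diag k)) ⟨
        entry C i k * (entry C k k * entry B k k)  ≡⟨ solve 3 (λ c d b → c :* (d :* b) := (c :* b) :* d) ≡.refl _ _ _ ⟩
        (entry C i k * entry B k k) * entry C k k  ≡⟨ ≡.cong (_* entry C k k) (pivot i (ℕ.<⇒≤ k<i)) ⟩
        δ i k * entry C k k                        ≡⟨ ≡.cong (_* entry C k k) (δ-off (λ i≡k → <-irrefl (≡.sym i≡k) k<i)) ⟩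
        0# * entry C k k                           ≡⟨ zeroˡ _ ⟩
        0#                                         ∎

  -- With E_{jl} the matrix unit: shear t B = B + t E_{jl}, shearInverse t C = C − t C E_{jl} C
  -- and translate A t K = K + t A E_{jl}.
  module Shear {n} (j l : Fin n) where

    shear : Carrier → Matrix n → Matrix n
    shear t B = B ⊕ (λ m → δ m j) ⊗ (λ k → t * δ l k)

    shearInverse : Carrier → Matrix n → Matrix n
    shearInverse t C = C ⊕ (λ m → entry C m j) ⊗ (λ k → (- t) * entry C l k)

    translate : Matrix n → Carrier → Matrix n → Matrix n
    translate A t K = K ⊕ (λ i → entry A i j) ⊗ (λ k → t * δ l k)

    ·-shear : ∀ A B t → A · shear t B ≡ translate A t (A · B)
    ·-shear A B t = matrix-ext λ i k → begin
      entry (A · shear t B) i k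
        ≡⟨ ·-⊕ A B _ _ i k ⟩
      entry (A · B) i k + sum (λ m → entry A i m * δ m j) * (t * δ l k)
        ≡⟨ ≡.cong (λ a → entry (A · B) i k + a * (t * δ l k)) (sum-*δ (entry A i) j) ⟩
      entry (A · B) i k + entry A i j * (t * δ l k)
        ≡⟨ entry-mkMatrix _ i k ⟨
      entry (translate A t (A · B)) i k
        ∎

    shear-upper : ∀ t B → j Fin.< l → UpperTriangular B → UpperTriangular (shear t B)
    shear-upper t B j<l B-upper m k k<m = begin
      entry (shear t B) m k              ≡⟨ entry-mkMatrix _ m k ⟩
      entry B m k + δ m j * (t * δ l k)  ≡⟨ ≡.cong₂ _+_ (B-upper m k k<m) unit-entry≡0 ⟩
      0# + 0#                            ≡⟨ +-identityʳ 0# ⟩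
      0#                                 ∎
      where
      unit-entry≡0 : δ m j * (t * δ l k) ≡ 0#
      unit-entry≡0 with m Fin.≟ j
      ... | yes ≡.refl =
        ≡.trans (≡.cong (λ d → δ m m * (t * d)) (δ-off (λ l≡k → <-irrefl (≡.sym l≡k) (<-trans k<m j<l))))
                (solve 2 (λ d t → d :* (t :* con 0) := con 0) ≡.refl _ t)
      ... | no  m≢j    = ≡.trans (≡.cong (_* (t * δ l k)) (δ-off m≢j)) (zeroˡ _)

    shear-· : ∀ t B C → B · C ≡ identity →
              ∀ a b → entry (shear t B · C) a b ≡ δ a b + δ a j * (t * entry C l b)
    shear-· t B C BC≡I a b = begin
      entry (shear t B · C) a b
        ≡⟨ ⊕-· B C _ _ a b ⟩
      entry (B · C) a b + δ a j * sum (λ m → (t * δ l m) * entry C m b)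
        ≡⟨ ≡.cong₂ (λ x y → x + δ a j * y) (≡.cong (λ M → entry M a b) BC≡I) row-l ⟩
      δ a b + δ a j * (t * entry C l b)
        ∎
      where
      row-l : sum (λ m → (t * δ l m) * entry C m b) ≡ t * entry C l b
      row-l = begin
        sum (λ m → (t * δ l m) * entry C m b)  ≡⟨ sum-cong-≗ (λ m → *-assoc t (δ l m) (entry C m b)) ⟩
        sum (λ m → t * (δ l m * entry C m b))  ≡⟨ *-distribˡ-sum t (λ m → δ l m * entry C m b) ⟨
        t * sum (λ m → δ l m * entry C m b)    ≡⟨ ≡.cong (t *_) (sum-δ* l (λ m → entry C m b)) ⟩
        t * entry C l b                        ∎

    ·-shear-inverse : ∀ t B C → C · B ≡ identity →
                      ∀ a b → entry (C · shear t B) a b ≡ δ a b + entry C a j * (t * δ l b)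
    ·-shear-inverse t B C CB≡I a b = begin
      entry (C · shear t B) a b
        ≡⟨ ·-⊕ C B _ _ a b ⟩
      entry (C · B) a b + sum (λ m → entry C a m * δ m j) * (t * δ l b)
        ≡⟨ ≡.cong₂ (λ x y → x + y * (t * δ l b)) (≡.cong (λ M → entry M a b) CB≡I) (sum-*δ (entry C a) j) ⟩
      δ a b + entry C a j * (t * δ l b)
        ∎

    shear-inverseʳ : ∀ t B C → B · C ≡ identity → entry C l j ≡ 0# → shear t B · shearInverse t C ≡ identity
    shear-inverseʳ t B C BC≡I Clj≡0 = matrix-ext λ i k → begin
      entry (shear t B · shearInverse t C) i k
        ≡⟨ ·-⊕ (shear t B) C _ _ i k ⟩
      entry (shear t B · C) i k + sum (λ m → entry (shear t B) i m * entry C m j) * ((- t) * entry C l k)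
        ≡⟨ ≡.cong₂ (λ x y → x + y * ((- t) * entry C l k)) (shear-· t B C BC≡I i k) (column-j i) ⟩
      δ i k + δ i j * (t * entry C l k) + δ i j * ((- t) * entry C l k)
        ≡⟨ +-*-cancel _ _ _ (-‿inverseʳ t) ⟩
      δ i k
        ∎
      where
      column-j : ∀ i → sum (λ m → entry (shear t B) i m * entry C m j) ≡ δ i j
      column-j i = begin
        sum (λ m → entry (shear t B) i m * entry C m j)  ≡⟨ entry-· (shear t B) C i j ⟨
        entry (shear t B · C) i j                        ≡⟨ shear-· t B C BC≡I i j ⟩
        δ i j + δ i j * (t * entry C l j)                ≡⟨ ≡.cong (λ c → δ i j + δ i j * (t * c)) Clj≡0 ⟩
        δ i j + δ i j * (t * 0#)                         ≡⟨ solve 3 (λ x y t → x :+ y :* (t :* con 0) := x) ≡.refl _ _ t ⟩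
        δ i j                                            ∎

    shear-inverseˡ : ∀ t B C → C · B ≡ identity → entry C l j ≡ 0# → shearInverse t C · shear t B ≡ identity
    shear-inverseˡ t B C CB≡I Clj≡0 = matrix-ext λ i k → begin
      entry (shearInverse t C · shear t B) i k
        ≡⟨ ⊕-· C (shear t B) _ _ i k ⟩
      entry (C · shear t B) i k + entry C i j * sum (λ m → ((- t) * entry C l m) * entry (shear t B) m k)
        ≡⟨ ≡.cong₂ (λ x y → x + entry C i j * y) (·-shear-inverse t B C CB≡I i k) (row-l k) ⟩
      δ i k + entry C i j * (t * δ l k) + entry C i j * ((- t) * δ l k)
        ≡⟨ +-*-cancel _ _ _ (-‿inverseʳ t) ⟩
      δ i k
        ∎
      where
      row-l : ∀ k → sum (λ m → ((- t) * entry C l m) * entry (shear t B) m k) ≡ (- t) * δ l k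
      row-l k = begin
        sum (λ m → ((- t) * entry C l m) * entry (shear t B) m k)
          ≡⟨ sum-cong-≗ (λ m → *-assoc (- t) (entry C l m) _) ⟩
        sum (λ m → (- t) * (entry C l m * entry (shear t B) m k))
          ≡⟨ *-distribˡ-sum (- t) (λ m → entry C l m * entry (shear t B) m k) ⟨
        (- t) * sum (λ m → entry C l m * entry (shear t B) m k)
          ≡⟨ ≡.cong ((- t) *_) (entry-· C (shear t B) l k) ⟨
        (- t) * entry (C · shear t B) l k
          ≡⟨ ≡.cong ((- t) *_) (·-shear-inverse t B C CB≡I l k) ⟩
        (- t) * (δ l k + entry C l j * (t * δ l k))
          ≡⟨ ≡.cong (λ c → (- t) * (δ l k + c * (t * δ l k))) Clj≡0 ⟩
        (- t) * (δ l k + 0# * (t * δ l k))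
          ≡⟨ ≡.cong ((- t) *_) (solve 3 (λ x t d → x :+ con 0 :* (t :* d) := x) ≡.refl _ t _) ⟩
        (- t) * δ l k
          ∎

    shear-B⁺ : ∀ t B → j Fin.< l → InB⁺ B → InB⁺ (shear t B)
    shear-B⁺ t B j<l ((C , BC≡I , CB≡I) , B-upper) =
      (shearInverse t C , shear-inverseʳ t B C BC≡I Clj≡0 , shear-inverseˡ t B C CB≡I Clj≡0) ,
      shear-upper t B j<l B-upper
      where
      Clj≡0 : entry C l j ≡ 0#
      Clj≡0 = inverse-upper B C B-upper CB≡I l j j<l

    translate-coset : ∀ A t {K} → j Fin.< l → InCoset A K → InCoset A (translate A t K)
    translate-coset A t j<l (B , B∈𝔹⁺ , ≡.refl) = shear t B , shear-B⁺ t B j<l B∈𝔹⁺ , ≡.sym (·-shear A B t)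

    translate-cancel : ∀ A K {s t} → s + t ≡ 0# → translate A t (translate A s K) ≡ K
    translate-cancel A K s+t≡0 = matrix-ext λ i k →
      ≡.trans (entry-mkMatrix _ i k) (≡.trans (≡.cong (_+ _) (entry-mkMatrix _ i k)) (+-*-cancel _ _ _ s+t≡0))

    σ-translate : ∀ A t K → σ (translate A t K) ≡ σ K + t * columnSum A j
    σ-translate A t K = begin
      σ (translate A t K)                                    ≡⟨ σ-⊕ K _ _ ⟩
      σ K + sum (λ i → entry A i j) * sum (λ k → t * δ l k)  ≡⟨ ≡.cong₂ (λ a b → σ K + a * b) (columnSum≡sum A j) unit-row ⟨
      σ K + columnSum A j * t                                ≡⟨ ≡.cong (σ K +_) (*-comm _ t) ⟩
      σ K + t * columnSum A j                                ∎
      where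
      unit-row : t ≡ sum (λ k → t * δ l k)
      unit-row = ≡.sym (≡.trans (sum-cong-≗ (λ k → *-comm t (δ l k))) (sum-δ* l (λ _ → t)))

module CharacterSums (F : FiniteField) {c ℓ : Level} (R : CommutativeRing c ℓ) where
  open FiniteField F using (elements; complete; unique; order; 0≢1)
    renaming (Carrier to 𝔽; _+_ to _+𝔽_; _*_ to _*𝔽_; 0# to 0𝔽)
  open FiniteFieldProperties F using (affine-↭)
  open CommutativeRing R
  open Target R
  open TargetProperties R
  open import Relation.Binary.Reasoning.Setoid setoid

  module _ (φ : 𝔽 ↔ Fin order) where
    open Inverse φ

    1<order : 1 < order
    1<order = distinct⇒1< (0≢1 ∘ Injection.injective (↔⇒↣ φ))

    character-sum≈0 : IntegralDomain → ∀ {ω} → PrimitiveRoot order ω →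
                      sumList (map (λ x → pow ω (toℕ (to x))) elements) ≈ 0#
    character-sum≈0 isDomain {ω} ω-primitive = begin
      sumList (map (λ x → pow ω (toℕ (to x))) elements)  ≡⟨ ≡.cong sumList (map-∘ elements) ⟩
      sumList (map (pow ω ∘ toℕ) (map to elements))      ≈⟨ sumList-↭ (↭.map⁺ _ to-↭) ⟩
      powerSum ω order                                   ≈⟨ powerSum≈0 ω isDomain 1<order ω-primitive ⟩
      0#                                                 ∎
      where
      to-↭ : map to elements ↭ allFin order
      to-↭ = map-↭ unique (Unique.allFin⁺ order) strictlyInverseʳ strictlyInverseˡ (λ _ → ∈-allFin _) (λ _ → complete _)

  translation-invariant-sum≈0 :
    (h : 𝔽 → Carrier) → sumList (map h elements) ≈ 0# →
    (σ : X → 𝔽) {a : 𝔽} → a ≢ 0𝔽 →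
    (T : 𝔽 → X → X) → (∀ t x → σ (T t x) ≡ σ x +𝔽 t *𝔽 a) →
    (L : List X) → (∀ t → map (T t) L ↭ L) →
    natMul order * sumList (map (h ∘ σ) L) ≈ 0#
  translation-invariant-sum≈0 h h-sum≈0 σ a≢0 T σ-T L T-↭ = begin
    natMul order * S
      ≈⟨ sumList-map-const S elements ⟨
    sumList (map (λ _ → S) elements)
      ≈⟨ sumList-map-cong elements (λ t → sym (T-invariant t)) ⟩
    sumList (map (λ t → sumList (map (λ x → h (σ (T t x))) L)) elements)
      ≈⟨ sumList-map-comm (λ t x → h (σ (T t x))) elements L ⟩
    sumList (map (λ x → sumList (map (λ t → h (σ (T t x))) elements)) L)
      ≈⟨ sumList-map-cong L orbit-sum≈0 ⟩
    sumList (map (λ _ → 0#) L)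
      ≈⟨ sumList-map-0# L ⟩
    0#
      ∎
    where
    S : Carrier
    S = sumList (map (h ∘ σ) L)

    T-invariant : ∀ t → sumList (map (λ x → h (σ (T t x))) L) ≈ S
    T-invariant t = begin
      sumList (map (λ x → h (σ (T t x))) L)  ≡⟨ ≡.cong sumList (map-∘ L) ⟩
      sumList (map (h ∘ σ) (map (T t) L))    ≈⟨ sumList-↭ (↭.map⁺ (h ∘ σ) (T-↭ t)) ⟩
      S                                      ∎

    orbit-sum≈0 : ∀ x → sumList (map (λ t → h (σ (T t x))) elements) ≈ 0#
    orbit-sum≈0 x = begin
      sumList (map (λ t → h (σ (T t x))) elements)          ≡⟨ ≡.cong sumList (map-cong (λ t → ≡.cong h (σ-T t x)) elements) ⟩
      sumList (map (λ t → h (σ x +𝔽 t *𝔽 _)) elements)      ≡⟨ ≡.cong sumList (map-∘ elements) ⟩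
      sumList (map h (map (λ t → σ x +𝔽 t *𝔽 _) elements))  ≈⟨ sumList-↭ (↭.map⁺ h (affine-↭ a≢0 (σ x))) ⟩
      sumList (map h elements)                              ≈⟨ h-sum≈0 ⟩
      0#                                                    ∎

lemma3p3 : {c ℓ : Level} (F : FiniteField) (C : CommutativeRing c ℓ) →
  let open FiniteField F
      open Matrices F
      open Target C
      module C = CommutativeRing C
  in
  (p k : ℕ) → Prime p → order ≡ p ^ k →
  IntegralDomain → Characteristic0 →
  (ω : C.Carrier) → PrimitiveRoot order ω →
  (φ : Carrier ↔ Fin order) → toℕ (Inverse.to φ 0#) ≡ 0 →
  (n : ℕ) → 2 ≤ n →
  (π : Permutation′ n) (u : Matrix n) → InUπ π u →
  (∃ λ (j : Fin n) → (suc (toℕ j) < n) × (columnSum (u · permMatrix π) j ≢ 0#)) →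
  (L : List (Matrix n)) → Unique L →
  (∀ K → (K ∈ L) ⇔ InCoset (u · permMatrix π) K) →
  sumList (map (λ K → pow ω (toℕ (Inverse.to φ (σ K)))) L) C.≈ C.0#
lemma3p3 F C _ _ _ _ isDomain char0 ω ω-primitive φ _ n _ π u _ (j , 1+j<n , a≢0) L L-unique L⇔coset =
  natMul-cancel isDomain char0 (ℕ.m<n⇒n≢0 (1<order φ))
    (translation-invariant-sum≈0 _ (character-sum≈0 φ isDomain ω-primitive) σ a≢0
       (translate A) (σ-translate A) L translate-↭)
  where
  open FiniteField F using (-_)
  open CommutativeRing (FiniteFieldProperties.ring F) using (-‿inverseʳ; -‿inverseˡ)
  open Matrices F
  open TargetProperties C
  open CharacterSums F C

  A : Matrix n
  A = u · permMatrix π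

  l : Fin n
  l = Fin.fromℕ< 1+j<n

  j<l : j Fin.< l
  j<l = ≡.subst (toℕ j <_) (≡.sym (toℕ-fromℕ< 1+j<n)) (ℕ.n<1+n (toℕ j))

  open MatrixProperties.Shear F j l

  translate-↭ : ∀ t → map (translate A t) L ↭ L
  translate-↭ t =
    map-↭ L-unique L-unique (λ K → translate-cancel A K (-‿inverseʳ t)) (λ K → translate-cancel A K (-‿inverseˡ t))
          (stays-in-L t) (stays-in-L (- t))
    where
    stays-in-L : ∀ t {K} → K ∈ L → translate A t K ∈ L
    stays-in-L t K∈L = Equivalence.from (L⇔coset _) (translate-coset A t j<l (Equivalence.to (L⇔coset _) K∈L))
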